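{- Let $n\ge3$, $k\ge0$, $m\ge2$, and let $C=\{(x_\alpha,y_\alpha):\alpha\in[m]\}$ be a strict alternating cycle in $\mathrm{Inc}(A,B)$ for the crown $S_n^k$. Then $mn\le 2(n+k)$.
   Context: The crown $S_n^k$ is the height-2 poset on $A\cup B$, $A=\{a_1,\dots,a_{n+k}\}$ minimal, $B=\{b_1,\dots,b_{n+k}\}$ maximal, indices cyclic mod $n+k$; $a_i$ is incomparable to $b_j$ iff $j\in\{i,\dots,i+k\}$ (mod $n+k$), otherwise $a_i<b_j$. $\mathrm{Inc}(A,B)$ is the set of incomparable pairs $(a,b)\in A\times B$. An indexed set $\{(x_\alpha,y_\alpha):\alpha\in[m]\}$ of incomparable pairs is an alternating cycle of size $m$ if $x_\alpha\le y_{\alpha-1}$ for all $\alpha$ (indices cyclic mod $m$, so $x_1\le y_m$); it is strict if $x_\alpha\le y_\beta$ holds iff $\beta=\alpha-1$. -}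

module Defs where

open import Data.Nat using (ℕ; zero; suc; _+_; _∸_; _≤_; NonZero)
open import Data.Nat.DivMod using (_%_; m%n<n)
open import Data.Fin using (Fin; toℕ; fromℕ<)
open import Relation.Nullary using (¬_)
open import Relation.Binary.PropositionalEquality using (_≡_)
open import Function.Bundles using (_⇔_)

offset : (N : ℕ) .{{_ : NonZero N}} → Fin N → Fin N → ℕ
offset N i j = (toℕ j + (N ∸ toℕ i)) % N

-- In the crown S_n^k (with N = n + k, indices 0..N-1 standing for 1..N):
-- a_i is incomparable to b_j iff j ∈ {i, i+1, ..., i+k} (mod N),
-- i.e. iff the cyclic offset from i to j is at most k.
Incomp : (n k : ℕ) .{{_ : NonZero (n + k)}} → Fin (n + k) → Fin (n + k) → Set
Incomp n k i j = offset (n + k) i j ≤ k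

-- a_i ≤ b_j in S_n^k (a_i ∈ A, b_j ∈ B, so this means a_i < b_j).
LeqAB : (n k : ℕ) .{{_ : NonZero (n + k)}} → Fin (n + k) → Fin (n + k) → Set
LeqAB n k i j = ¬ Incomp n k i j

cpred : (m : ℕ) .{{_ : NonZero m}} → Fin m → Fin m
cpred m α = fromℕ< (m%n<n (toℕ α + (m ∸ 1)) m)

record StrictAltCycle (n k m : ℕ) .{{_ : NonZero (n + k)}} .{{_ : NonZero m}} : Set where
  field
    x : Fin m → Fin (n + k)
    y : Fin m → Fin (n + k)
    inc : ∀ α → Incomp n k (x α) (y α)
    strict : ∀ α β → LeqAB n k (x α) (y β) ⇔ (β ≡ cpred m α)

-- Let J_α be the cyclic interval of the n − 1 elements of B above a_{x α}.  By
-- strictness, y_{α−1} is the only y in J_α, and it cuts J_α into an initial arc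
-- ending at y_{α−1} and a final arc starting at y_{α−1}, of total size n.  Two
-- initial arcs never meet: at a common point p, the y that comes first after p
-- would lie in both intervals.  Dually, two final arcs never meet, since the y
-- that comes last before p lies in both.
module Submission where

open import Defs
open import Data.Nat using (ℕ; suc; _+_; _*_; _∸_; _≤_; _<_; s≤s; NonZero; _<?_)
open import Data.Nat.Properties
open import Data.Nat.DivMod
open import Data.Nat.Solver using (module +-*-Solver)
open import Data.Fin as Fin using (Fin; toℕ; fromℕ<)
open import Data.Fin.Properties using (toℕ<n; toℕ-injective; toℕ-fromℕ<; *↔×; injective⇒≤)
open import Data.Product using (_×_; _,_; proj₁; proj₂)
open import Data.Sum using ([_,_]′)
open import Function using (_∘_)
open import Function.Bundles using (Equivalence; Injection; mk↣)
open import Function.Properties.Inverse using (↔⇒↣; ↔-sym)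
open import Function.Construct.Composition using (_↣-∘_)
open import Relation.Binary.PropositionalEquality
open import Relation.Nullary using (¬_; yes; no; contradiction)

[m%n+o]%n≡[m+o]%n : ∀ m o n .{{_ : NonZero n}} → (m % n + o) % n ≡ (m + o) % n
[m%n+o]%n≡[m+o]%n m o n = begin
  (m % n + o) % n          ≡⟨ %-distribˡ-+ (m % n) o n ⟩
  (m % n % n + o % n) % n  ≡⟨ cong (λ r → (r + o % n) % n) (m%n%n≡m%n m n) ⟩
  (m % n + o % n) % n      ≡⟨ %-distribˡ-+ m o n ⟨
  (m + o) % n              ∎
  where open ≡-Reasoning

%-+-cancelʳ : ∀ {a b o n} .{{_ : NonZero n}} → a < n → b < n → o ≤ n →
              (a + o) % n ≡ (b + o) % n → a ≡ b
%-+-cancelʳ {a} {b} {o} {n} a<n b<n o≤n eq = begin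
  a                            ≡⟨ undo a<n ⟨
  ((a + o) % n + (n ∸ o)) % n  ≡⟨ cong (λ r → (r + (n ∸ o)) % n) eq ⟩
  ((b + o) % n + (n ∸ o)) % n  ≡⟨ undo b<n ⟩
  b                            ∎
  where
  open ≡-Reasoning
  undo : ∀ {c} → c < n → ((c + o) % n + (n ∸ o)) % n ≡ c
  undo {c} c<n = begin
    ((c + o) % n + (n ∸ o)) % n  ≡⟨ [m%n+o]%n≡[m+o]%n (c + o) (n ∸ o) n ⟩
    (c + o + (n ∸ o)) % n        ≡⟨ cong (_% n) (trans (+-assoc c o (n ∸ o)) (cong (c +_) (m+[n∸m]≡n o≤n))) ⟩
    (c + n) % n                  ≡⟨ [m+n]%n≡m%n c n ⟩
    c % n                        ≡⟨ m<n⇒m%n≡m c<n ⟩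
    c                            ∎

cpred-injective : ∀ m .{{_ : NonZero m}} {α β : Fin m} → cpred m α ≡ cpred m β → α ≡ β
cpred-injective m {α} {β} eq =
  toℕ-injective (%-+-cancelʳ (toℕ<n α) (toℕ<n β) (m∸n≤m m 1)
    (trans (sym (toℕ-fromℕ< _)) (trans (cong toℕ eq) (toℕ-fromℕ< _))))

module CyclicOffset (N : ℕ) .{{_ : NonZero N}} where

  offset<N : ∀ a b → offset N a b < N
  offset<N a b = m%n<n _ N

  offset-triangle : ∀ a b c → (offset N a b + offset N b c) % N ≡ offset N a c
  offset-triangle a b c = begin
    ((b′ + (N ∸ a′)) % N + (c′ + (N ∸ b′)) % N) % N  ≡⟨ %-distribˡ-+ (b′ + (N ∸ a′)) (c′ + (N ∸ b′)) N ⟨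
    ((b′ + (N ∸ a′)) + (c′ + (N ∸ b′))) % N          ≡⟨ cong (_% N) (swap b′ (N ∸ a′) c′ (N ∸ b′)) ⟩
    ((c′ + (N ∸ a′)) + (b′ + (N ∸ b′))) % N          ≡⟨ cong (λ r → ((c′ + (N ∸ a′)) + r) % N) (m+[n∸m]≡n (<⇒≤ (toℕ<n b))) ⟩
    ((c′ + (N ∸ a′)) + N) % N                        ≡⟨ [m+n]%n≡m%n (c′ + (N ∸ a′)) N ⟩
    offset N a c                                     ∎
    where
    open ≡-Reasoning
    open +-*-Solver
    a′ = toℕ a
    b′ = toℕ b
    c′ = toℕ c
    swap : ∀ u v w z → (u + v) + (w + z) ≡ (w + v) + (u + z)
    swap = solve 4 (λ u v w z → (u :+ v) :+ (w :+ z) := (w :+ v) :+ (u :+ z)) refl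

  -- Going from a to c through b adds up exactly unless it winds once around.
  offset-additive : ∀ a b c → offset N a b + offset N b c < offset N a c + N →
                    offset N a b + offset N b c ≡ offset N a c
  offset-additive a b c bound with (offset N a b + offset N b c) / N | m≡m%n+[m/n]*n (offset N a b + offset N b c) N
  ... | 0     | s≡ = trans s≡ (trans (+-identityʳ _) (offset-triangle a b c))
  ... | suc q | s≡ = contradiction bound (≤⇒≯ (begin
    offset N a c + N     ≡⟨ cong (_+ N) (offset-triangle a b c) ⟨
    s % N + N            ≤⟨ +-monoʳ-≤ (s % N) (m≤m+n N (q * N)) ⟩
    s % N + (N + q * N)  ≡⟨ s≡ ⟨
    s                    ∎))
    where
    open ≤-Reasoning
    s = offset N a b + offset N b c

  offset-additive-< : ∀ a b c → offset N a b + offset N b c < N →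
                      offset N a b + offset N b c ≡ offset N a c
  offset-additive-< a b c s<N = offset-additive a b c (<-≤-trans s<N (m≤n+m N _))

  offset-additiveˡ : ∀ a b c → offset N a b ≤ offset N a c →
                     offset N a b + offset N b c ≡ offset N a c
  offset-additiveˡ a b c ab≤ac =
    offset-additive a b c (≤-<-trans (+-monoˡ-≤ _ ab≤ac) (+-monoʳ-< _ (offset<N b c)))

  offset-additiveʳ : ∀ a b c → offset N b c ≤ offset N a c →
                     offset N a b + offset N b c ≡ offset N a c
  offset-additiveʳ a b c bc≤ac =
    offset-additive a b c (<-≤-trans (+-mono-<-≤ (offset<N a b) bc≤ac) (≤-reflexive (+-comm N _)))

  shift : Fin N → ℕ → Fin N
  shift a s = fromℕ< (m%n<n (toℕ a + s) N)

  offset-shift : ∀ a {s} → s < N → offset N a (shift a s) ≡ s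
  offset-shift a {s} s<N = begin
    (toℕ (shift a s) + (N ∸ toℕ a)) % N      ≡⟨ cong (λ r → (r + (N ∸ toℕ a)) % N) (toℕ-fromℕ< _) ⟩
    ((toℕ a + s) % N + (N ∸ toℕ a)) % N      ≡⟨ [m%n+o]%n≡[m+o]%n (toℕ a + s) (N ∸ toℕ a) N ⟩
    (toℕ a + s + (N ∸ toℕ a)) % N            ≡⟨ cong (_% N) rearrange ⟩
    (s + N) % N                              ≡⟨ [m+n]%n≡m%n s N ⟩
    s % N                                    ≡⟨ m<n⇒m%n≡m s<N ⟩
    s                                        ∎
    where
    open ≡-Reasoning
    rearrange : toℕ a + s + (N ∸ toℕ a) ≡ s + N
    rearrange = begin
      toℕ a + s + (N ∸ toℕ a)    ≡⟨ cong (_+ (N ∸ toℕ a)) (+-comm (toℕ a) s) ⟩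
      s + toℕ a + (N ∸ toℕ a)    ≡⟨ +-assoc s (toℕ a) (N ∸ toℕ a) ⟩
      s + (toℕ a + (N ∸ toℕ a))  ≡⟨ cong (s +_) (m+[n∸m]≡n (<⇒≤ (toℕ<n a))) ⟩
      s + N                      ∎

  shift-injective : ∀ a {s t} → s < N → t < N → shift a s ≡ shift a t → s ≡ t
  shift-injective a s<N t<N eq =
    trans (sym (offset-shift a s<N)) (trans (cong (offset N a) eq) (offset-shift a t<N))

module _ {n k m : ℕ} .{{_ : NonZero (n + k)}} .{{_ : NonZero m}} (C : StrictAltCycle n k m) where
  open StrictAltCycle C
  open CyclicOffset (n + k)

  private
    N : ℕ
    N = n + k

  x<y-pred : ∀ α → k < offset N (x α) (y (cpred m α))
  x<y-pred α = ≰⇒> (Equivalence.from (strict α (cpred m α)) refl)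

  x<y⇒pred : ∀ α γ → k < offset N (x α) (y γ) → γ ≡ cpred m α
  x<y⇒pred α γ x<y = Equivalence.to (strict α γ) (<⇒≱ x<y)

  span : Fin m → ℕ
  span α = offset N (x α) (y (cpred m α))

  Initial : Fin m → Fin N → Set
  Initial α p = k < offset N (x α) p × offset N (x α) p ≤ span α

  Final : Fin m → Fin N → Set
  Final α p = span α ≤ offset N (x α) p

  initial-absorbs : ∀ {α β p} → Initial β p →
                    offset N p (y (cpred m α)) ≤ offset N p (y (cpred m β)) →
                    cpred m α ≡ cpred m β
  initial-absorbs {α} {β} {p} (k<p , p≤span) nearer = x<y⇒pred β (cpred m α) (begin-strict
    k                                              <⟨ k<p ⟩
    offset N (x β) p                               ≤⟨ m≤m+n _ _ ⟩
    offset N (x β) p + offset N p (y (cpred m α))  ≡⟨ offset-additive-< (x β) p _ no-wrap ⟩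
    offset N (x β) (y (cpred m α))                 ∎)
    where
    open ≤-Reasoning
    no-wrap : offset N (x β) p + offset N p (y (cpred m α)) < N
    no-wrap = begin-strict
      offset N (x β) p + offset N p (y (cpred m α))  ≤⟨ +-monoʳ-≤ _ nearer ⟩
      offset N (x β) p + offset N p (y (cpred m β))  ≡⟨ offset-additiveˡ (x β) p _ p≤span ⟩
      span β                                         <⟨ offset<N (x β) _ ⟩
      N                                              ∎

  final-absorbs : ∀ {α β p} → Final α p →
                  offset N (y (cpred m β)) p ≤ offset N (y (cpred m α)) p →
                  cpred m β ≡ cpred m α
  final-absorbs {α} {β} {p} span≤p nearer = x<y⇒pred α (cpred m β) (begin-strict
    k                        <⟨ x<y-pred α ⟩
    span α                   ≤⟨ m≤m+n _ _ ⟩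
    span α + offset N yα yβ  ≡⟨ offset-additive-< (x α) yα yβ no-wrap ⟩
    offset N (x α) yβ        ∎)
    where
    open ≤-Reasoning
    yα = y (cpred m α)
    yβ = y (cpred m β)
    no-wrap : span α + offset N yα yβ < N
    no-wrap = begin-strict
      span α + offset N yα yβ                    ≤⟨ +-monoʳ-≤ (span α) (m≤m+n _ _) ⟩
      span α + (offset N yα yβ + offset N yβ p)  ≡⟨ cong (span α +_) (offset-additiveʳ yα yβ p nearer) ⟩
      span α + offset N yα p                     ≡⟨ offset-additiveˡ (x α) yα p span≤p ⟩
      offset N (x α) p                           <⟨ offset<N (x α) p ⟩
      N                                          ∎

  initial-unique : ∀ {α β p} → Initial α p → Initial β p → α ≡ β
  initial-unique iα iβ = cpred-injective m
    ([ initial-absorbs iβ , sym ∘ initial-absorbs iα ]′ (≤-total _ _))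

  final-unique : ∀ {α β p} → Final α p → Final β p → α ≡ β
  final-unique fα fβ = cpred-injective m
    ([ sym ∘ final-absorbs fα , final-absorbs fβ ]′ (≤-total _ _))

  k+j<N : (j : Fin n) → k + toℕ j < N
  k+j<N j = subst (k + toℕ j <_) (+-comm k n) (+-monoʳ-< k (toℕ<n j))

  initial-shift : ∀ α (j : Fin n) → k + toℕ j < span α → Initial α (shift (x α) (suc (k + toℕ j)))
  initial-shift α j k+j<span =
    subst (λ o → k < o × o ≤ span α) (sym (offset-shift (x α) (≤-<-trans k+j<span (offset<N (x α) _))))
      (s≤s (m≤m+n k (toℕ j)) , k+j<span)

  final-shift : ∀ α (j : Fin n) → ¬ k + toℕ j < span α → Final α (shift (x α) (k + toℕ j))
  final-shift α j k+j≮span = subst (span α ≤_) (sym (offset-shift (x α) (k+j<N j))) (≮⇒≥ k+j≮span)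

  -- Slot j of α goes to offset k + 1 + j from x α while that stays in the
  -- initial arc, and to offset k + j (in the final arc) afterwards.
  encode : Fin m × Fin n → Fin 2 × Fin N
  encode (α , j) with k + toℕ j <? span α
  ... | yes _ = Fin.zero , shift (x α) (suc (k + toℕ j))
  ... | no _  = Fin.suc Fin.zero , shift (x α) (k + toℕ j)

  encode-injective : ∀ {i i′} → encode i ≡ encode i′ → i ≡ i′
  encode-injective {α , j} {β , j′} eq with k + toℕ j <? span α | k + toℕ j′ <? span β
  ... | yes lt | yes lt′
    with refl ← initial-unique (initial-shift α j lt) (subst (Initial β) (sym (cong proj₂ eq)) (initial-shift β j′ lt′))
    = cong (α ,_) (toℕ-injective (+-cancelˡ-≡ k _ _ (suc-injective
        (shift-injective (x α) (≤-<-trans lt (offset<N (x α) _)) (≤-<-trans lt′ (offset<N (x α) _)) (cong proj₂ eq)))))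
  ... | no ge  | no ge′
    with refl ← final-unique (final-shift α j ge) (subst (Final β) (sym (cong proj₂ eq)) (final-shift β j′ ge′))
    = cong (α ,_) (toℕ-injective (+-cancelˡ-≡ k _ _ (shift-injective (x α) (k+j<N j) (k+j<N j′) (cong proj₂ eq))))
  ... | yes _  | no _   = contradiction (cong proj₁ eq) λ ()
  ... | no _   | yes _  = contradiction (cong proj₁ eq) λ ()

lemma4p2 : (n k m : ℕ) → 3 ≤ n → 2 ≤ m →
    .{{_ : NonZero (n + k)}} .{{_ : NonZero m}} →
    StrictAltCycle n k m → m * n ≤ 2 * (n + k)
lemma4p2 n k m _ _ C =
  injective⇒≤ (Injection.injective (↔⇒↣ (↔-sym *↔×) ↣-∘ (mk↣ (encode-injective C) ↣-∘ ↔⇒↣ *↔×)))
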